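{- For no non-negative integer $n$ does there exist a corresponding sequence for $g(n)$ of length $2$.
   Context: For a non-negative integer $n$, $g(n)$ is the least integer $k$ such that there exists a strictly increasing sequence of integers $n = a_1 < a_2 < \cdots < a_t = k$ ($t \geq 1$) whose product is a perfect square. A corresponding sequence for $g(n)$ is such a strictly increasing sequence with square product whose first term is $n$ and whose last term is $g(n)$; its length is $t$. -}

module Defs where

open import Data.Nat using (ℕ; _*_; _<_; _≤_)
open import Data.List using (List; []; _∷_)
open import Data.Nat.ListAction using (product)
open import Data.List.Relation.Unary.Linked using (Linked)
open import Data.Product using (Σ; ∃; _×_)
open import Relation.Binary.PropositionalEquality using (_≡_)

IsSquare : ℕ → Set
IsSquare m = ∃ λ r → r * r ≡ m

lastOf : ℕ → List ℕ → ℕ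
lastOf x []       = x
lastOf _ (y ∷ ys) = lastOf y ys

CorrSeq : ℕ → ℕ → List ℕ → Set
CorrSeq n k ys = Linked _<_ (n ∷ ys) × lastOf n ys ≡ k × IsSquare (product (n ∷ ys))

IsG : ℕ → ℕ → Set
IsG n k = (∃ λ ys → CorrSeq n k ys) × (∀ k′ ys → CorrSeq n k′ ys → k ≤ k′)

-- If n < m and n·m is a square, then n = t·a² and m = t·b² with a < b. Either n is
-- itself a square, so the one-term sequence (n) already beats m, or t ≥ 2 and a ≥ 1,
-- and then
--   t·a² < t·a² + a < t·a² + t·a < t·a² + t·a + a + 1 < t·(a + 1)² ≤ m
-- is a sequence with square product, since its terms are t·a², a·(t·a + 1),
-- t·a·(a + 1) and (t·a + 1)·(a + 1).
module Submission where

open import Defs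
open import Data.Nat
open import Data.Nat.Properties
open import Data.Nat.Divisibility using (_∣_; divides)
open import Data.Nat.DivMod using (_/_; m/n*n≡m)
open import Data.Nat.GCD using (gcd; gcd[m,n]∣m; gcd[m,n]∣n; gcd[m,n]≢0)
open import Data.Nat.Coprimality using (Coprime; coprime-/gcd; coprime-divisor)
open import Data.Nat.ListAction using (product)
open import Data.Nat.Tactic.RingSolver using (solve-∀; solve)
open import Data.List using (List; []; _∷_; length)
open import Data.List.Relation.Unary.Linked using (Linked; [-]) renaming (_∷_ to _∷ˡ_)
open import Data.Product using (∃-syntax; _×_; _,_)
open import Data.Sum using (_⊎_; inj₁; inj₂)
open import Relation.Nullary using (¬_)
open import Relation.Binary.PropositionalEquality

ScaledSquares : ℕ → ℕ → Set
ScaledSquares n m = ∃[ t ] ∃[ a ] ∃[ b ] n ≡ t * a * a × m ≡ t * b * b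

coprime-split-*≡square⇒scaledSquares :
  ∀ {n m r g a b} .{{_ : NonZero n}} .{{_ : NonZero g}} →
  Coprime a b → n ≡ a * g → r ≡ b * g → n * m ≡ r * r → ScaledSquares n m
coprime-split-*≡square⇒scaledSquares {n} {m} {r} {g} {a} {b} cop n≡ag r≡bg nm≡r² =
  t , a , b , n≡taa , m≡tbb t g≡ta
  where
  open ≡-Reasoning
  am≡bbg : a * m ≡ b * (b * g)
  am≡bbg = *-cancelˡ-≡ _ _ g (begin
    g * (a * m)       ≡⟨ solve (g ∷ a ∷ m ∷ []) ⟩
    (a * g) * m       ≡⟨ cong (_* m) n≡ag ⟨
    n * m             ≡⟨ nm≡r² ⟩
    r * r             ≡⟨ cong₂ _*_ r≡bg r≡bg ⟩
    (b * g) * (b * g) ≡⟨ solve (g ∷ b ∷ []) ⟩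
    g * (b * (b * g)) ∎)
  a∣g : a ∣ g
  a∣g = coprime-divisor cop (coprime-divisor cop (divides m (trans (sym am≡bbg) (*-comm a m))))
  open _∣_ a∣g renaming (quotient to t; equality to g≡ta)
  n≡taa : n ≡ t * a * a
  n≡taa = trans n≡ag (trans (*-comm a g) (cong (_* a) g≡ta))
  instance
    a≢0 : NonZero a
    a≢0 = ≢-nonZero λ a≡0 → ≢-nonZero⁻¹ n (trans n≡ag (cong (_* g) a≡0))
  -- t is taken as a variable here: the ring solver cannot treat the quotient as an atom.
  m≡tbb : ∀ t → g ≡ t * a → m ≡ t * b * b
  m≡tbb t g≡ta = *-cancelˡ-≡ _ _ a (begin
    a * m             ≡⟨ am≡bbg ⟩
    b * (b * g)       ≡⟨ cong (λ x → b * (b * x)) g≡ta ⟩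
    b * (b * (t * a)) ≡⟨ solve (a ∷ b ∷ t ∷ []) ⟩
    a * (t * b * b)   ∎)

*≡square⇒scaledSquares : ∀ n m r .{{_ : NonZero n}} → n * m ≡ r * r → ScaledSquares n m
*≡square⇒scaledSquares n m r = coprime-split-*≡square⇒scaledSquares
  (coprime-/gcd n r) (sym (m/n*n≡m (gcd[m,n]∣m n r))) (sym (m/n*n≡m (gcd[m,n]∣n n r)))
  where
  instance
    g≢0 : NonZero (gcd n r)
    g≢0 = ≢-nonZero (gcd[m,n]≢0 n r (inj₁ (≢-nonZero⁻¹ n)))

isG-≤-square : ∀ {n k} → IsG n k → IsSquare n → k ≤ n
isG-≤-square {n} (_ , least) (r , r²≡n) =
  least n [] ([-] , refl , r , trans r²≡n (sym (*-identityʳ n)))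

scaled-square-or-large : ∀ t a → IsSquare (t * a * a) ⊎ (1 < t × NonZero a)
scaled-square-or-large 0               a       = inj₁ (0 , refl)
scaled-square-or-large 1               a       = inj₁ (a , cong (_* a) (sym (*-identityˡ a)))
scaled-square-or-large t@(suc (suc _)) 0       = inj₁ (0 , sym (*-zeroʳ (t * 0)))
scaled-square-or-large (suc (suc _))   (suc _) = inj₂ (s<s z<s , _)

completion : ℕ → ℕ → List ℕ
completion t a = t * a * a + a ∷ t * a * a + t * a ∷ t * a * a + t * a + suc a ∷ []

completion-isSquare : ∀ t a → IsSquare (product (t * a * a ∷ completion t a))
completion-isSquare t a = t * a * a * suc a * (t * a + 1) , expanded t a
  where
  expanded : ∀ t a →
    (t * a * a * suc a * (t * a + 1)) * (t * a * a * suc a * (t * a + 1)) ≡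
    t * a * a * ((t * a * a + a) * ((t * a * a + t * a) * ((t * a * a + t * a + suc a) * 1)))
  expanded = solve-∀

m<n*m : ∀ m n .{{_ : NonZero m}} → 1 < n → m < n * m
m<n*m m n 1<n = subst (m <_) (*-comm m n) (m<m*n m n 1<n)

completion-linked : ∀ {t a} → 1 < t → .{{NonZero a}} → Linked _<_ (t * a * a ∷ completion t a)
completion-linked {t} {a} 1<t =
  m<m+n N (>-nonZero⁻¹ a) ∷ˡ +-monoʳ-< N (m<n*m a t 1<t) ∷ˡ m<m+n (N + t * a) z<s ∷ˡ [-]
  where N = t * a * a

completion-corrSeq : ∀ {t a} → 1 < t → .{{NonZero a}} →
                     CorrSeq (t * a * a) (t * a * a + t * a + suc a) (completion t a)
completion-corrSeq {t} {a} 1<t = completion-linked 1<t , refl , completion-isSquare t a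

completion-last< : ∀ {t} a → 1 < t → t * a * a + t * a + suc a < t * suc a * suc a
completion-last< {t} a 1<t = begin-strict
  t * a * a + t * a + suc a      <⟨ +-monoʳ-< (t * a * a + t * a) (m<n*m (suc a) t 1<t) ⟩
  t * a * a + t * a + t * suc a  ≡⟨ solve (t ∷ a ∷ []) ⟩
  t * suc a * suc a              ∎
  where open ≤-Reasoning

isG-<-scaled : ∀ {t a k} → 1 < t → .{{NonZero a}} → IsG (t * a * a) k → k < t * suc a * suc a
isG-<-scaled {t} {a} 1<t (_ , least) =
  ≤-<-trans (least _ (completion t a) (completion-corrSeq 1<t)) (completion-last< a 1<t)

scaledSquares-<⇒¬isG : ∀ {n m} → n < m → ScaledSquares n m → ¬ IsG n m
scaledSquares-<⇒¬isG n<m (t , a , b , refl , refl) g with scaled-square-or-large t a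
... | inj₁ n-square    = <⇒≱ n<m (isG-≤-square g n-square)
... | inj₂ (1<t , a≢0) = <⇒≱ (isG-<-scaled 1<t {{a≢0}} g) (*-mono-≤ (*-monoʳ-≤ t a<b) a<b)
  where
  a<b : a < b
  a<b = ≰⇒> λ b≤a → <⇒≱ n<m (*-mono-≤ (*-monoʳ-≤ t b≤a) b≤a)

square-pair-<⇒¬isG : ∀ {n m} → n < m → IsSquare (n * m) → ¬ IsG n m
square-pair-<⇒¬isG {zero}      n<m _         g = <⇒≱ n<m (isG-≤-square g (0 , refl))
square-pair-<⇒¬isG {n@(suc _)} n<m (r , r²≡nm) =
  scaledSquares-<⇒¬isG n<m (*≡square⇒scaledSquares n _ r (sym r²≡nm))

corollary3p8 : (n k : ℕ) (ys : List ℕ) → IsG n k → CorrSeq n k ys → length (n ∷ ys) ≢ 2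
corollary3p8 n k []          _ _ ()
corollary3p8 n k (_ ∷ _ ∷ _) _ _ ()
corollary3p8 n k (m ∷ []) g (n<m ∷ˡ [-] , refl , r , r²≡nm) _ =
  square-pair-<⇒¬isG n<m (r , trans r²≡nm (cong (n *_) (*-identityʳ m))) g
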